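{- Let $\mathcal L$ be one of the logics $L4$, $L5$, $ELn^-$, $ELn$, $EkLn^-$, $EkLn$ with $n\in\{4,5\}$ and $k\in\{4,5,6\}$ (i.e. a logic of the hierarchy below containing (A4)). Let $\mathcal L'$ be the system obtained from $\mathcal L$ by replacing the axiom scheme (A3) with the distribution scheme $\square(\varphi\rightarrow\psi)\rightarrow(\square\varphi\rightarrow\square\psi)$ and (if present) the axiom scheme (CoRe) with the scheme $\square\varphi\rightarrow K\varphi$ (with rules MP and AN, the latter now applying to the axioms of $\mathcal L'$, and theorem scheme (TND)). Then $\mathcal L$ and $\mathcal L'$ are deductively equivalent, i.e. for all sets $\Phi$ and formulas $\varphi$, $\Phi\vdash_{\mathcal L}\varphi$ iff $\Phi\vdash_{\mathcal L'}\varphi$.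
   Context: Formulas $Fm$ are built from an infinite set $V$ of propositional variables using $\bot,\wedge,\vee,\rightarrow$ and unary operators $\square$ and $K$; $Fm_1$ is the set of formulas without $K$. Abbreviations: $\neg\varphi:=\varphi\rightarrow\bot$, $\top:=\neg\bot$, $\varphi\leftrightarrow\psi:=(\varphi\rightarrow\psi)\wedge(\psi\rightarrow\varphi)$. Axiom schemes: (INT) all theorems of intuitionistic propositional logic and their substitution-instances; (A1) $\square(\varphi\vee\psi)\rightarrow(\square\varphi\vee\square\psi)$; (A2) $\square\varphi\rightarrow\varphi$; (A3) $\square(\varphi\rightarrow\psi)\rightarrow\square(\square\varphi\rightarrow\square\psi)$; (A4) $\square\varphi\rightarrow\square\square\varphi$; (A5) $\neg\square\varphi\rightarrow\square\neg\square\varphi$; (KBel) $K(\varphi\rightarrow\psi)\rightarrow(K\varphi\rightarrow K\psi)$; (CoRe) $\square\varphi\rightarrow\square K\varphi$; (IntRe) $K\varphi\rightarrow\neg\neg\varphi$; (E4) $K\varphi\rightarrow KK\varphi$; (E5) $\neg K\varphi\rightarrow K\neg K\varphi$; (PNB) $K\varphi\rightarrow\square K\varphi$; (NNB) $\neg K\varphi\rightarrow\square\neg K\varphi$. Theorem scheme (TND): $\varphi\vee\neg\varphi$. Rules: Modus Ponens (MP); Axiom Necessitation (AN): if $\varphi$ is an axiom of the system, infer $\square\varphi$ (AN applies only to axioms). $\Phi\vdash_{\mathcal L}\varphi$ means there is a finite sequence ending in $\varphi$ each member of which is an axiom of $\mathcal L$, a member of $\Phi$, an instance of (TND), a formula $\square\psi$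 with $\psi$ an axiom of $\mathcal L$, or follows from two earlier members by MP. Systems: $L3$ (language $Fm_1$) has axiom schemes (INT),(A1),(A2),(A3), theorem scheme (TND), rules MP, AN; $L4=L3+$(A4); $L5=L4+$(A5). Over $Fm$: $EL3^-=L3+$(KBel)$+$(CoRe), $EL4^-=EL3^-+$(A4), $EL5^-=EL4^-+$(A5); for $n\in\{3,4,5\}$: $E4Ln^-=ELn^-+$(E4), $E5Ln^-=E4Ln^-+$(E5), $E6Ln^-=ELn^-+$(PNB)$+$(NNB), $ELn=ELn^-+$(IntRe), $EkLn=EkLn^-+$(IntRe) for $k\in\{4,5,6\}$. -}

module Defs where

open import Data.Nat using (ℕ)
open import Data.Bool using (Bool; true; false; T) renaming (_∨_ to _or_)
open import Data.Product using (Σ; _×_; _,_)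
open import Relation.Binary.PropositionalEquality using (_≡_)

-- Formulas.  Fm true = Fm (language with K), Fm false = Fm₁ (no K).
-- Propositional variables V = ℕ (an infinite set).

infixr 5 _⇒_
infixl 6 _⋁_
infixl 7 _⋀_

data Fm : Bool → Set where
  var  : ∀ {b} → ℕ → Fm b
  ⊥ᶠ   : ∀ {b} → Fm b
  _⋀_  : ∀ {b} → Fm b → Fm b → Fm b
  _⋁_  : ∀ {b} → Fm b → Fm b → Fm b
  _⇒_  : ∀ {b} → Fm b → Fm b → Fm b
  □    : ∀ {b} → Fm b → Fm b
  K    : Fm true → Fm true

¬ᶠ_ : ∀ {b} → Fm b → Fm b
¬ᶠ φ = φ ⇒ ⊥ᶠ

⊤ᶠ : ∀ {b} → Fm b
⊤ᶠ = ¬ᶠ ⊥ᶠ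

_⇔_ : ∀ {b} → Fm b → Fm b → Fm b
φ ⇔ ψ = (φ ⇒ ψ) ⋀ (ψ ⇒ φ)

data PFm : Set where
  pvar : ℕ → PFm
  p⊥   : PFm
  _p∧_ _p∨_ _p→_ : PFm → PFm → PFm

data IPC : PFm → Set where
  ax-k : ∀ {p q} → IPC (p p→ (q p→ p))
  ax-s : ∀ {p q r} → IPC ((p p→ (q p→ r)) p→ ((p p→ q) p→ (p p→ r)))
  ∧e₁ : ∀ {p q} → IPC ((p p∧ q) p→ p)
  ∧e₂ : ∀ {p q} → IPC ((p p∧ q) p→ q)
  ∧i  : ∀ {p q} → IPC (p p→ (q p→ (p p∧ q)))
  ∨i₁ : ∀ {p q} → IPC (p p→ (p p∨ q))
  ∨i₂ : ∀ {p q} → IPC (q p→ (p p∨ q))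
  ∨e  : ∀ {p q r} → IPC ((p p→ r) p→ ((q p→ r) p→ ((p p∨ q) p→ r)))
  efq : ∀ {p} → IPC (p⊥ p→ p)
  mp  : ∀ {p q} → IPC p → IPC (p p→ q) → IPC q

substP : ∀ {b} → (ℕ → Fm b) → PFm → Fm b
substP σ (pvar x)  = σ x
substP σ p⊥        = ⊥ᶠ
substP σ (p p∧ q)  = substP σ p ⋀ substP σ q
substP σ (p p∨ q)  = substP σ p ⋁ substP σ q
substP σ (p p→ q)  = substP σ p ⇒ substP σ q

-- (INT): theorems of IPC and their substitution instances.
INT : ∀ {b} → Fm b → Set
INT {b} φ = Σ PFm λ p → Σ (ℕ → Fm b) λ σ → IPC p × (substP σ p ≡ φ)

data Scheme : Set where
  A1 A2 A3 A4 A5 KBel CoRe IntRe E4 E5 PNB NNB Dist CoReK : Scheme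

data Inst : ∀ {b} → Scheme → Fm b → Set where
  a1    : ∀ {b} {φ ψ : Fm b} → Inst A1 (□ (φ ⋁ ψ) ⇒ (□ φ ⋁ □ ψ))
  a2    : ∀ {b} {φ : Fm b} → Inst A2 (□ φ ⇒ φ)
  a3    : ∀ {b} {φ ψ : Fm b} → Inst A3 (□ (φ ⇒ ψ) ⇒ □ (□ φ ⇒ □ ψ))
  a4    : ∀ {b} {φ : Fm b} → Inst A4 (□ φ ⇒ □ (□ φ))
  a5    : ∀ {b} {φ : Fm b} → Inst A5 (¬ᶠ □ φ ⇒ □ (¬ᶠ □ φ))
  kbel  : ∀ {φ ψ} → Inst KBel (K (φ ⇒ ψ) ⇒ (K φ ⇒ K ψ))
  core  : ∀ {φ} → Inst CoRe (□ φ ⇒ □ (K φ))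
  intre : ∀ {φ} → Inst IntRe (K φ ⇒ ¬ᶠ ¬ᶠ φ)
  e4    : ∀ {φ} → Inst E4 (K φ ⇒ K (K φ))
  e5    : ∀ {φ} → Inst E5 (¬ᶠ K φ ⇒ K (¬ᶠ K φ))
  pnb   : ∀ {φ} → Inst PNB (K φ ⇒ □ (K φ))
  nnb   : ∀ {φ} → Inst NNB (¬ᶠ K φ ⇒ □ (¬ᶠ K φ))
  dist  : ∀ {b} {φ ψ : Fm b} → Inst Dist (□ (φ ⇒ ψ) ⇒ (□ φ ⇒ □ ψ))
  corek : ∀ {φ} → Inst CoReK (□ φ ⇒ K φ)

record System : Set where
  field
    lang : Bool
    has  : Scheme → Bool
open System public

data Axiom (S : System) : Fm (lang S) → Set where
  int  : ∀ {φ} → INT φ → Axiom S φ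
  inst : ∀ {s φ} → T (has S s) → Inst s φ → Axiom S φ

-- Derivability Φ ⊢[ S ] φ (derivation trees = finite Hilbert sequences).
data Derives (S : System) (Φ : Fm (lang S) → Set) : Fm (lang S) → Set where
  ax  : ∀ {φ} → Axiom S φ → Derives S Φ φ
  hyp : ∀ {φ} → Φ φ → Derives S Φ φ
  tnd : ∀ {φ} → Derives S Φ (φ ⋁ ¬ᶠ φ)
  an  : ∀ {φ} → Axiom S φ → Derives S Φ (□ φ)
  mp  : ∀ {φ ψ} → Derives S Φ φ → Derives S Φ (φ ⇒ ψ) → Derives S Φ ψ


data N45 : Set where n4 n5 : N45
data K456 : Set where k4 k5 k6 : K456

data Logic : Set where
  L      : N45 → Logic
  EL⁻    : N45 → Logic
  EL     : N45 → Logic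
  EkL⁻   : K456 → N45 → Logic
  EkL    : K456 → N45 → Logic

baseL : N45 → Scheme → Bool
baseL n A1 = true
baseL n A2 = true
baseL n A3 = true
baseL n A4 = true
baseL n5 A5 = true
baseL _ _ = false

elMinus : Scheme → Bool
elMinus KBel = true
elMinus CoRe = true
elMinus _ = false

intRe : Scheme → Bool
intRe IntRe = true
intRe _ = false

ek : K456 → Scheme → Bool
ek k4 E4 = true
ek k5 E4 = true
ek k5 E5 = true
ek k6 PNB = true
ek k6 NNB = true
ek _ _ = false

sys : Logic → System
sys (L n)      = record { lang = false ; has = λ s → baseL n s }
sys (EL⁻ n)    = record { lang = true ; has = λ s → baseL n s or elMinus s }
sys (EL n)     = record { lang = true ; has = λ s → baseL n s or elMinus s or intRe s }
sys (EkL⁻ k n) = record { lang = true ; has = λ s → baseL n s or elMinus s or ek k s }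
sys (EkL k n)  = record { lang = true ; has = λ s → baseL n s or elMinus s or ek k s or intRe s }

prime : System → System
prime S = record { lang = lang S ; has = h }
  where
  h : Scheme → Bool
  h A3    = false
  h Dist  = has S A3
  h CoRe  = false
  h CoReK = has S CoRe
  h s     = has S s

module Submission where

-- Call a formula a theorem of a system if it is derivable without hypotheses and without (TND).
-- Theorems are closed under necessitation as soon as (A4) and the distribution scheme are
-- theorems: □ of an axiom is an instance of AN, □□ψ follows from □ψ by (A4), and MP is
-- necessitated by distribution.  Hence a derivation in one system transfers to another one as
-- soon as every axiom of the first is a theorem of the second, an application of AN being
-- replaced by the necessitation of such a theorem.  Between 𝓛 and 𝓛' this holds because
-- (A3) and (CoRe) follow from distribution and □φ → Kφ after one application of (A4), while
-- conversely distribution and □φ → Kφ follow from (A3) and (CoRe) by (A2).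

open import Defs
open import Data.Nat using (ℕ)
open import Data.Bool using (Bool; T)
open import Data.Empty using (⊥-elim)
open import Data.Product using (_×_; _,_)
open import Relation.Nullary using (¬_)
open import Relation.Binary.PropositionalEquality using (refl)

data Theorem (S : System) : Fm (lang S) → Set where
  axiom     : ∀ {φ} → Axiom S φ → Theorem S φ
  nec-axiom : ∀ {φ} → Axiom S φ → Theorem S (□ φ)
  mp        : ∀ {φ ψ} → Theorem S φ → Theorem S (φ ⇒ ψ) → Theorem S ψ

Theorem⇒Derives : ∀ {S Φ φ} → Theorem S φ → Derives S Φ φ
Theorem⇒Derives (axiom x)     = ax x
Theorem⇒Derives (nec-axiom x) = an x
Theorem⇒Derives (mp d e)      = mp (Theorem⇒Derives d) (Theorem⇒Derives e)

ipc-syllogism : ∀ p q r → IPC ((q p→ r) p→ ((p p→ q) p→ (p p→ r)))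
ipc-syllogism p q r = mp ax-k (mp (mp ax-s ax-k) ax-s)

⇒-trans : ∀ {S} {φ ψ χ : Fm (lang S)} →
  Theorem S (φ ⇒ ψ) → Theorem S (ψ ⇒ χ) → Theorem S (φ ⇒ χ)
⇒-trans {φ = φ} {ψ} {χ} φ⇒ψ ψ⇒χ =
  mp φ⇒ψ (mp ψ⇒χ (axiom (int (_ , σ , ipc-syllogism (pvar 0) (pvar 1) (pvar 2) , refl))))
  where
  σ : ℕ → Fm _
  σ 0 = φ
  σ 1 = ψ
  σ _ = χ

ProvesDist : System → Set
ProvesDist S = ∀ {φ ψ : Fm (lang S)} → Theorem S (□ (φ ⇒ ψ) ⇒ (□ φ ⇒ □ ψ))

ClosedUnderNec : System → Set
ClosedUnderNec S = ∀ {φ} → Theorem S φ → Theorem S (□ φ)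

closedUnderNec : ∀ {S} → T (has S A4) → ProvesDist S → ClosedUnderNec S
closedUnderNec h4 dist⊢ (axiom x)     = nec-axiom x
closedUnderNec h4 dist⊢ (nec-axiom x) = mp (nec-axiom x) (axiom (inst h4 a4))
closedUnderNec h4 dist⊢ (mp d e)      =
  mp (closedUnderNec h4 dist⊢ d) (mp (closedUnderNec h4 dist⊢ e) dist⊢)

□⇒□-from-□□⇒ : ∀ {S} {φ ψ : Fm (lang S)} → T (has S A4) → ProvesDist S →
  Theorem S (□ (□ φ ⇒ ψ)) → Theorem S (□ φ ⇒ □ ψ)
□⇒□-from-□□⇒ h4 dist⊢ d = ⇒-trans (axiom (inst h4 a4)) (mp d dist⊢)

dist-from-A2-A3 : ∀ {S} → T (has S A2) → T (has S A3) → ProvesDist S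
dist-from-A2-A3 h2 h3 = ⇒-trans (axiom (inst h3 a3)) (axiom (inst h2 a2))

system : Bool → (Scheme → Bool) → System
system b h = record { lang = b ; has = h }

derives-transfer : ∀ {b h h′} →
  (∀ {φ} → Axiom (system b h) φ → Theorem (system b h′) φ) →
  ClosedUnderNec (system b h′) →
  ∀ {Φ φ} → Derives (system b h) Φ φ → Derives (system b h′) Φ φ
derives-transfer axiom⊢ nec (ax x)   = Theorem⇒Derives (axiom⊢ x)
derives-transfer axiom⊢ nec (hyp x)  = hyp x
derives-transfer axiom⊢ nec tnd      = tnd
derives-transfer axiom⊢ nec (an x)   = Theorem⇒Derives (nec (axiom⊢ x))
derives-transfer axiom⊢ nec (mp d e) =
  mp (derives-transfer axiom⊢ nec d) (derives-transfer axiom⊢ nec e)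

module _ {b : Bool} {h : Scheme → Bool} where

  private
    S  = system b h
    S′ = prime S

  axiom⇒prime-theorem : T (h A3) → T (h A4) → ¬ T (h CoReK) →
    ∀ {φ} → Axiom S φ → Theorem S′ φ
  axiom⇒prime-theorem h3 h4 noCoReK (int x)        = axiom (int x)
  axiom⇒prime-theorem h3 h4 noCoReK (inst p a1)    = axiom (inst p a1)
  axiom⇒prime-theorem h3 h4 noCoReK (inst p a2)    = axiom (inst p a2)
  axiom⇒prime-theorem h3 h4 noCoReK (inst p a3)    =
    □⇒□-from-□□⇒ h4 (axiom (inst h3 dist)) (nec-axiom (inst h3 dist))
  axiom⇒prime-theorem h3 h4 noCoReK (inst p a4)    = axiom (inst p a4)
  axiom⇒prime-theorem h3 h4 noCoReK (inst p a5)    = axiom (inst p a5)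
  axiom⇒prime-theorem h3 h4 noCoReK (inst p kbel)  = axiom (inst p kbel)
  axiom⇒prime-theorem h3 h4 noCoReK (inst p core)  =
    □⇒□-from-□□⇒ h4 (axiom (inst h3 dist)) (nec-axiom (inst p corek))
  axiom⇒prime-theorem h3 h4 noCoReK (inst p intre) = axiom (inst p intre)
  axiom⇒prime-theorem h3 h4 noCoReK (inst p e4)    = axiom (inst p e4)
  axiom⇒prime-theorem h3 h4 noCoReK (inst p e5)    = axiom (inst p e5)
  axiom⇒prime-theorem h3 h4 noCoReK (inst p pnb)   = axiom (inst p pnb)
  axiom⇒prime-theorem h3 h4 noCoReK (inst p nnb)   = axiom (inst p nnb)
  axiom⇒prime-theorem h3 h4 noCoReK (inst p dist)  = axiom (inst h3 dist)
  axiom⇒prime-theorem h3 h4 noCoReK (inst p corek) = ⊥-elim (noCoReK p)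

  prime-axiom⇒theorem : T (h A2) → T (h A3) → ∀ {φ} → Axiom S′ φ → Theorem S φ
  prime-axiom⇒theorem h2 h3 (int x)        = axiom (int x)
  prime-axiom⇒theorem h2 h3 (inst p a1)    = axiom (inst p a1)
  prime-axiom⇒theorem h2 h3 (inst p a2)    = axiom (inst p a2)
  prime-axiom⇒theorem h2 h3 (inst () a3)
  prime-axiom⇒theorem h2 h3 (inst p a4)    = axiom (inst p a4)
  prime-axiom⇒theorem h2 h3 (inst p a5)    = axiom (inst p a5)
  prime-axiom⇒theorem h2 h3 (inst p kbel)  = axiom (inst p kbel)
  prime-axiom⇒theorem h2 h3 (inst () core)
  prime-axiom⇒theorem h2 h3 (inst p intre) = axiom (inst p intre)
  prime-axiom⇒theorem h2 h3 (inst p e4)    = axiom (inst p e4)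
  prime-axiom⇒theorem h2 h3 (inst p e5)    = axiom (inst p e5)
  prime-axiom⇒theorem h2 h3 (inst p pnb)   = axiom (inst p pnb)
  prime-axiom⇒theorem h2 h3 (inst p nnb)   = axiom (inst p nnb)
  prime-axiom⇒theorem h2 h3 (inst p dist)  = dist-from-A2-A3 h2 p
  prime-axiom⇒theorem h2 h3 (inst p corek) =
    ⇒-trans (axiom (inst p core)) (axiom (inst h2 a2))

  derives⇒prime-derives : T (h A3) → T (h A4) → ¬ T (h CoReK) →
    ∀ {Φ φ} → Derives S Φ φ → Derives S′ Φ φ
  derives⇒prime-derives h3 h4 noCoReK =
    derives-transfer (axiom⇒prime-theorem h3 h4 noCoReK)
      (closedUnderNec h4 (axiom (inst h3 dist)))

  prime-derives⇒derives : T (h A2) → T (h A3) → T (h A4) →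
    ∀ {Φ φ} → Derives S′ Φ φ → Derives S Φ φ
  prime-derives⇒derives h2 h3 h4 =
    derives-transfer (prime-axiom⇒theorem h2 h3)
      (closedUnderNec h4 (dist-from-A2-A3 h2 h3))

sys-has-A2-A3-A4 : ∀ ℒ → T (has (sys ℒ) A2) × T (has (sys ℒ) A3) × T (has (sys ℒ) A4)
sys-has-A2-A3-A4 (L _)       = _
sys-has-A2-A3-A4 (EL⁻ _)     = _
sys-has-A2-A3-A4 (EL _)      = _
sys-has-A2-A3-A4 (EkL⁻ _ _)  = _
sys-has-A2-A3-A4 (EkL _ _)   = _

sys-lacks-CoReK : ∀ ℒ → ¬ T (has (sys ℒ) CoReK)
sys-lacks-CoReK (L _) ()
sys-lacks-CoReK (EL⁻ _) ()
sys-lacks-CoReK (EL _) ()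
sys-lacks-CoReK (EkL⁻ k4 _) ()
sys-lacks-CoReK (EkL⁻ k5 _) ()
sys-lacks-CoReK (EkL⁻ k6 _) ()
sys-lacks-CoReK (EkL k4 _) ()
sys-lacks-CoReK (EkL k5 _) ()
sys-lacks-CoReK (EkL k6 _) ()

corollary3p3 : (ℒ : Logic) (Φ : Fm (lang (sys ℒ)) → Set) (φ : Fm (lang (sys ℒ))) →
    (Derives (sys ℒ) Φ φ → Derives (prime (sys ℒ)) Φ φ) ×
    (Derives (prime (sys ℒ)) Φ φ → Derives (sys ℒ) Φ φ)
corollary3p3 ℒ _ _ =
  let (h2 , h3 , h4) = sys-has-A2-A3-A4 ℒ in
  derives⇒prime-derives h3 h4 (sys-lacks-CoReK ℒ) ,
  prime-derives⇒derives h2 h3 h4
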